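{- Let $n,m,k,\ell,c$ be positive integers with $m=n<k+\ell$, and consider the equation $x^n+y^m=c\,x^k y^\ell$ in positive integers $x,y$. If $c=2$, the equation has the unique solution $(x,y)=(1,1)$. If $c\ge 3$, the equation has no positive integer solutions. If $c=1$ and $k+\ell=n+1$, the equation has the unique solution $(x,y)=(2,2)$. If $c=1$ and $k+\ell-n\ge 2$, the equation has no positive integer solutions.
   Context: A solution means an ordered pair $(x,y)$ of positive integers satisfying the equation. -}

module Defs where

open import Data.Nat using (ℕ; _+_; _*_; _^_; _<_)
open import Data.Product using (_×_)
open import Relation.Binary.PropositionalEquality using (_≡_)

Solution : (n m k ℓ c x y : ℕ) → Set
Solution n m k ℓ c x y = 0 < x × 0 < y × (x ^ n + y ^ m ≡ c * (x ^ k * y ^ ℓ))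

{-# OPTIONS --safe #-}
module Submission where

-- Write x = a g and y = b g with g = gcd x y and a, b coprime.  Since
-- k + ℓ = n + s with s = k + ℓ - n ≥ 1, dividing the equation by g^n gives
-- a^n + b^n = c g^s a^k b^ℓ.  Then a divides b^n and b divides a^n, so
-- a = b = 1 by coprimality, i.e. x = y = g and c g^s = 2.  The four cases
-- are read off from this last equation.

open import Defs
open import Data.Nat using (ℕ; zero; suc; _+_; _*_; _^_; _∸_; _<_; _≤_; z≤n; s≤s; z<s; NonZero; ≢-nonZero)
open import Data.Nat.Properties
open import Data.Nat.Divisibility using (_∣_; divides; ∣1⇒≡1; ∣m+n∣m⇒∣n; ∣m⇒∣m*n; ∣n⇒∣m*n; m∣m*n)
open import Data.Nat.GCD using (GCD; gcd; gcd-GCD; GCD-*; gcd[m,n]∣m; gcd[m,n]∣n; gcd[m,n]≢0)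
open import Data.Nat.Coprimality as Coprime using (Coprime; GCD≡1⇒coprime; coprime-divisor)
open import Algebra.Properties.CommutativeSemigroup *-commutativeSemigroup using (interchange; x∙yz≈y∙zx; x∙yz≈y∙xz)
open import Data.Product using (_×_; _,_; proj₁; proj₂)
open import Data.Sum using (inj₁)
open import Relation.Binary.PropositionalEquality
open import Relation.Nullary using (¬_)
open import Function.Base using (_∘_)
open import Function.Bundles using (_⇔_; mk⇔)

^-distribʳ-* : ∀ m n o → (m * n) ^ o ≡ m ^ o * n ^ o
^-distribʳ-* m n zero    = refl
^-distribʳ-* m n (suc o) = begin
  m * n * (m * n) ^ o        ≡⟨ cong (m * n *_) (^-distribʳ-* m n o) ⟩
  m * n * (m ^ o * n ^ o)    ≡⟨ interchange m n (m ^ o) (n ^ o) ⟩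
  m * m ^ o * (n * n ^ o)    ∎
  where open ≡-Reasoning

m∣m^n : ∀ m {n} → 0 < n → m ∣ m ^ n
m∣m^n m {suc n} _ = m∣m*n (m ^ n)

coprime-∣^⇒≡1 : ∀ {a b} n → Coprime a b → a ∣ b ^ n → a ≡ 1
coprime-∣^⇒≡1 zero    _   a∣1     = ∣1⇒≡1 a∣1
coprime-∣^⇒≡1 (suc n) cop a∣b^1+n = coprime-∣^⇒≡1 n cop (coprime-divisor cop a∣b^1+n)

coprime-solution⇒≡1 : ∀ {n k ℓ d a b} → 0 < n → 0 < k → 0 < ℓ → Coprime a b →
  a ^ n + b ^ n ≡ d * (a ^ k * b ^ ℓ) → a ≡ 1 × b ≡ 1
coprime-solution⇒≡1 {n} {k} {ℓ} {d} {a} {b} n>0 k>0 ℓ>0 cop eq =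
  coprime-∣^⇒≡1 n cop a∣b^n , coprime-∣^⇒≡1 n (Coprime.sym cop) b∣a^n
  where
  a∣b^n : a ∣ b ^ n
  a∣b^n = ∣m+n∣m⇒∣n (subst (a ∣_) (sym eq) (∣n⇒∣m*n d (∣m⇒∣m*n (b ^ ℓ) (m∣m^n a k>0))))
                    (m∣m^n a n>0)
  b∣a^n : b ∣ a ^ n
  b∣a^n = ∣m+n∣m⇒∣n (subst (b ∣_) (trans (sym eq) (+-comm (a ^ n) (b ^ n)))
                                  (∣n⇒∣m*n d (∣n⇒∣m*n (a ^ k) (m∣m^n b ℓ>0))))
                    (m∣m^n b n>0)

scaled-equation⇒reduced : ∀ {n k ℓ s c a b g} .{{_ : NonZero g}} → k + ℓ ≡ n + s →
  (a * g) ^ n + (b * g) ^ n ≡ c * ((a * g) ^ k * (b * g) ^ ℓ) →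
  a ^ n + b ^ n ≡ c * g ^ s * (a ^ k * b ^ ℓ)
scaled-equation⇒reduced {n} {k} {ℓ} {s} {c} {a} {b} {g} k+ℓ≡n+s eq =
  *-cancelˡ-≡ _ _ (g ^ n) {{m^n≢0 g n}} (begin
    g ^ n * (a ^ n + b ^ n)                    ≡⟨ *-distribˡ-+ (g ^ n) (a ^ n) (b ^ n) ⟩
    g ^ n * a ^ n + g ^ n * b ^ n              ≡⟨ cong₂ _+_ (*-comm (g ^ n) (a ^ n)) (*-comm (g ^ n) (b ^ n)) ⟩
    a ^ n * g ^ n + b ^ n * g ^ n              ≡⟨ cong₂ _+_ (^-distribʳ-* a g n) (^-distribʳ-* b g n) ⟨
    (a * g) ^ n + (b * g) ^ n                  ≡⟨ eq ⟩
    c * ((a * g) ^ k * (b * g) ^ ℓ)            ≡⟨ cong₂ (λ u v → c * (u * v)) (^-distribʳ-* a g k) (^-distribʳ-* b g ℓ) ⟩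
    c * (a ^ k * g ^ k * (b ^ ℓ * g ^ ℓ))      ≡⟨ cong (c *_) (interchange (a ^ k) (g ^ k) (b ^ ℓ) (g ^ ℓ)) ⟩
    c * (a ^ k * b ^ ℓ * (g ^ k * g ^ ℓ))      ≡⟨ cong (λ u → c * (a ^ k * b ^ ℓ * u)) g^k*g^ℓ≡g^n*g^s ⟩
    c * (a ^ k * b ^ ℓ * (g ^ n * g ^ s))      ≡⟨ cong (c *_) (x∙yz≈y∙zx (a ^ k * b ^ ℓ) (g ^ n) (g ^ s)) ⟩
    c * (g ^ n * (g ^ s * (a ^ k * b ^ ℓ)))    ≡⟨ x∙yz≈y∙xz c (g ^ n) _ ⟩
    g ^ n * (c * (g ^ s * (a ^ k * b ^ ℓ)))    ≡⟨ cong (g ^ n *_) (*-assoc c (g ^ s) _) ⟨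
    g ^ n * (c * g ^ s * (a ^ k * b ^ ℓ))      ∎)
  where
  open ≡-Reasoning
  g^k*g^ℓ≡g^n*g^s : g ^ k * g ^ ℓ ≡ g ^ n * g ^ s
  g^k*g^ℓ≡g^n*g^s = begin
    g ^ k * g ^ ℓ  ≡⟨ ^-distribˡ-+-* g k ℓ ⟨
    g ^ (k + ℓ)    ≡⟨ cong (g ^_) k+ℓ≡n+s ⟩
    g ^ (n + s)    ≡⟨ ^-distribˡ-+-* g n s ⟩
    g ^ n * g ^ s  ∎

gcd-cofactors≡1 : ∀ {n k ℓ s c a b g} .{{_ : NonZero g}} → 0 < n → 0 < k → 0 < ℓ →
  k + ℓ ≡ n + s → GCD (a * g) (b * g) (1 * g) →
  (a * g) ^ n + (b * g) ^ n ≡ c * ((a * g) ^ k * (b * g) ^ ℓ) →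
  a ≡ 1 × b ≡ 1 × c * g ^ s ≡ 2
gcd-cofactors≡1 {n} {k} {ℓ} {s} {c} {a} {b} {g} n>0 k>0 ℓ>0 k+ℓ≡n+s gcd≡g eq
  with reduced ← scaled-equation⇒reduced {n} {k} {ℓ} {s} {c} {a} {b} {g} k+ℓ≡n+s eq
  with coprime-solution⇒≡1 {n} {k} {ℓ} {c * g ^ s} {a} {b} n>0 k>0 ℓ>0 (GCD≡1⇒coprime (GCD-* gcd≡g)) reduced
... | refl , refl = refl , refl , (begin
  c * g ^ s                    ≡⟨ *-identityʳ _ ⟨
  c * g ^ s * (1 * 1)          ≡⟨ cong₂ (λ u v → c * g ^ s * (u * v)) (^-zeroˡ k) (^-zeroˡ ℓ) ⟨
  c * g ^ s * (1 ^ k * 1 ^ ℓ)  ≡⟨ reduced ⟨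
  1 ^ n + 1 ^ n                ≡⟨ cong₂ _+_ (^-zeroˡ n) (^-zeroˡ n) ⟩
  2                            ∎)
  where open ≡-Reasoning

solution⇒diagonal : ∀ {n k ℓ s c x y} → 0 < n → 0 < k → 0 < ℓ → k + ℓ ≡ n + s →
  Solution n n k ℓ c x y → x ≡ y × c * x ^ s ≡ 2
solution⇒diagonal {n} {k} {ℓ} {s} {c} {x} {y} n>0 k>0 ℓ>0 k+ℓ≡n+s (x>0 , _ , eq) =
  reduce (gcd[m,n]∣m x y) (gcd[m,n]∣n x y)
  where
  g : ℕ
  g = gcd x y
  instance
    g≢0 : NonZero g
    g≢0 = ≢-nonZero (gcd[m,n]≢0 x y (inj₁ (n>0⇒n≢0 x>0)))
  reduce : g ∣ x → g ∣ y → x ≡ y × c * x ^ s ≡ 2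
  reduce (divides a x≡a*g) (divides b y≡b*g)
    with gcd-cofactors≡1 {n} {k} {ℓ} {s} {c} {a} {b} {g} n>0 k>0 ℓ>0 k+ℓ≡n+s
           (subst₂ (λ u v → GCD u v (1 * g)) x≡a*g y≡b*g
                   (subst (GCD x y) (sym (*-identityˡ g)) (gcd-GCD x y)))
           (subst₂ (λ u v → u ^ n + v ^ n ≡ c * (u ^ k * v ^ ℓ)) x≡a*g y≡b*g eq)
  ... | refl , refl , c*g^s≡2 =
    trans x≡a*g (sym y≡b*g) , subst (λ u → c * u ^ s ≡ 2) (sym (trans x≡a*g (*-identityˡ g))) c*g^s≡2

diagonal⇒solution : ∀ {n k ℓ s c x} → k + ℓ ≡ n + s → 0 < x → c * x ^ s ≡ 2 →
  Solution n n k ℓ c x x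
diagonal⇒solution {n} {k} {ℓ} {s} {c} {x} k+ℓ≡n+s x>0 c*x^s≡2 = x>0 , x>0 , (begin
  x ^ n + x ^ n        ≡⟨ cong (x ^ n +_) (+-identityʳ (x ^ n)) ⟨
  2 * x ^ n            ≡⟨ cong (_* x ^ n) c*x^s≡2 ⟨
  c * x ^ s * x ^ n    ≡⟨ *-assoc c (x ^ s) (x ^ n) ⟩
  c * (x ^ s * x ^ n)  ≡⟨ cong (c *_) (^-distribˡ-+-* x s n) ⟨
  c * x ^ (s + n)      ≡⟨ cong (λ t → c * x ^ t) (trans (+-comm s n) (sym k+ℓ≡n+s)) ⟩
  c * x ^ (k + ℓ)      ≡⟨ cong (c *_) (^-distribˡ-+-* x k ℓ) ⟩
  c * (x ^ k * x ^ ℓ)  ∎)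
  where open ≡-Reasoning

m^n≡1⇒m≡1 : ∀ {m n} → 0 < n → m ^ n ≡ 1 → m ≡ 1
m^n≡1⇒m≡1 {m} {suc n} _ m^[1+n]≡1 = m*n≡1⇒m≡1 m (m ^ n) m^[1+n]≡1

m^n≡2⇒m≡2×n≡1 : ∀ {m n} → m ^ n ≡ 2 → m ≡ 2 × n ≡ 1
m^n≡2⇒m≡2×n≡1 {m} {suc zero} m^1≡2 = trans (sym (*-identityʳ m)) m^1≡2 , refl
m^n≡2⇒m≡2×n≡1 {zero} {suc (suc n)} ()
m^n≡2⇒m≡2×n≡1 {suc zero} {suc (suc n)} 1^n≡2 with trans (sym (^-zeroˡ (2 + n))) 1^n≡2
... | ()
m^n≡2⇒m≡2×n≡1 {m@(suc (suc _))} {suc (suc n)} m^[2+n]≡2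
  with subst (4 ≤_) m^[2+n]≡2 (*-mono-≤ 2≤m (*-mono-≤ 2≤m (m^n>0 m n)))
  where
  2≤m : 2 ≤ m
  2≤m = s≤s (s≤s z≤n)
... | s≤s (s≤s ())

m*n^o≡2⇒m≤2 : ∀ {m n o} → 0 < n → m * n ^ o ≡ 2 → m ≤ 2
m*n^o≡2⇒m≤2 {m} {n@(suc _)} {o} _ m*n^o≡2 = subst (m ≤_) m*n^o≡2 (m≤m*n m (n ^ o) {{m^n≢0 n o}})

theorem7 : (n m k ℓ c : ℕ) → 0 < n → 0 < m → 0 < k → 0 < ℓ → 0 < c →
    m ≡ n → n < k + ℓ →
    (c ≡ 2 → (x y : ℕ) → Solution n m k ℓ c x y ⇔ (x ≡ 1 × y ≡ 1))
    × (3 ≤ c → (x y : ℕ) → ¬ Solution n m k ℓ c x y)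
    × (c ≡ 1 → k + ℓ ≡ n + 1 → (x y : ℕ) → Solution n m k ℓ c x y ⇔ (x ≡ 2 × y ≡ 2))
    × (c ≡ 1 → 2 ≤ (k + ℓ) ∸ n → (x y : ℕ) → ¬ Solution n m k ℓ c x y)
theorem7 n .n k ℓ c n>0 _ k>0 ℓ>0 _ refl n<k+ℓ = case-c≡2 , case-c≥3 , case-c≡1-s≡1 , case-c≡1-s≥2
  where
  s : ℕ
  s = k + ℓ ∸ n
  k+ℓ≡n+s : k + ℓ ≡ n + s
  k+ℓ≡n+s = sym (m+[n∸m]≡n (<⇒≤ n<k+ℓ))
  diagonal : ∀ {x y} → Solution n n k ℓ c x y → x ≡ y × c * x ^ s ≡ 2
  diagonal = solution⇒diagonal {n} {k} {ℓ} {s} {c} n>0 k>0 ℓ>0 k+ℓ≡n+s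
  on-diagonal : ∀ {x y d} → Solution n n k ℓ c x y → (c * x ^ s ≡ 2 → x ≡ d) → x ≡ d × y ≡ d
  on-diagonal sol x≡d with diagonal sol
  ... | refl , c*x^s≡2 = x≡d c*x^s≡2 , x≡d c*x^s≡2

  case-c≡2 : c ≡ 2 → (x y : ℕ) → Solution n n k ℓ c x y ⇔ (x ≡ 1 × y ≡ 1)
  case-c≡2 refl x y = mk⇔
    (λ sol → on-diagonal sol (m^n≡1⇒m≡1 (m<n⇒0<n∸m n<k+ℓ) ∘ *-cancelˡ-≡ _ 1 2))
    (λ { (refl , refl) → diagonal⇒solution {n} {k} {ℓ} {s} {2} k+ℓ≡n+s z<s (cong (2 *_) (^-zeroˡ s)) })

  case-c≥3 : 3 ≤ c → (x y : ℕ) → ¬ Solution n n k ℓ c x y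
  case-c≥3 3≤c x y sol = ≤⇒≯ (m*n^o≡2⇒m≤2 {o = s} (proj₁ sol) (proj₂ (diagonal sol))) 3≤c

  case-c≡1-s≡1 : c ≡ 1 → k + ℓ ≡ n + 1 → (x y : ℕ) → Solution n n k ℓ c x y ⇔ (x ≡ 2 × y ≡ 2)
  case-c≡1-s≡1 refl k+ℓ≡n+1 x y = mk⇔
    (λ sol → on-diagonal sol (proj₁ ∘ m^n≡2⇒m≡2×n≡1 {n = s} ∘ trans (sym (*-identityˡ _))))
    (λ { (refl , refl) → diagonal⇒solution {n} {k} {ℓ} {1} {1} k+ℓ≡n+1 z<s refl })

  case-c≡1-s≥2 : c ≡ 1 → 2 ≤ s → (x y : ℕ) → ¬ Solution n n k ℓ c x y
  case-c≡1-s≥2 refl 2≤s x y sol =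
    ≤⇒≯ (≤-reflexive (proj₂ (m^n≡2⇒m≡2×n≡1 {n = s} (trans (sym (*-identityˡ _)) (proj₂ (diagonal sol)))))) 2≤s
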